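{- Let $(L,\leq)$ be a finite lattice. Then the join label of a cover relation $\mathcal{R}_1\lessdot\mathcal{R}$ in the lattice of transfer systems on $L$ is $\operatorname{Tr}(a,b)$, where $(a,b)$ is the unique non-trivial relation in $\mathcal{R}$ that lifts on the left every relation of $\mathcal{R}_1$.
   Context: A transfer system on $L$ is a subposet $\lhd$ of $\leq$ such that $x\lhd y$ and $w\leq y$ imply $x\wedge w\lhd w$; they form a semidistributive lattice under inclusion. A relation $(a,b)$ lifts on the left $(c,d)$ if $a\leq c$, $b\leq d$ imply $b\leq c$. $\operatorname{Tr}(a,b)$ is the smallest transfer system containing $(a,b)$; these are exactly the join-irreducible transfer systems, with unique lower cover $\operatorname{Tr}(a,b)_*=\operatorname{Tr}(a,b)\setminus\{(a,b)\}$. In a join-semidistributive lattice, the join label of a cover $x\lessdot y$ is the unique join-irreducible $j$ with $x\vee j=y$ and $x\vee j_*=x$. -}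

module Defs where

open import Data.Bool using (Bool; true; false)
open import Data.Nat using (ℕ)
open import Data.Fin using (Fin)
open import Data.Product using (Σ; ∃; _×_; _,_)
open import Data.Sum using (_⊎_)
open import Function.Bundles using (_↔_)
open import Relation.Nullary using (¬_)
open import Relation.Binary using (Decidable)
open import Relation.Binary.PropositionalEquality using (_≡_; _≢_)
open import Relation.Binary.Lattice.Structures using (IsLattice)

-- A finite lattice (L, ≤, ∨, ∧): equality is propositional equality,
-- the carrier is in bijection with some Fin n, and ≤ is decidable
-- (automatic classically for a finite poset).
record FiniteLattice : Set₁ where
  field
    Carrier   : Set
    _≤_       : Carrier → Carrier → Set
    _∨_       : Carrier → Carrier → Carrier
    _∧_       : Carrier → Carrier → Carrier
    isLattice : IsLattice _≡_ _≤_ _∨_ _∧_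
    _≤?_      : Decidable _≤_
    size      : ℕ
    finite    : Carrier ↔ Fin size

module TransferSystems (L : FiniteLattice) where
  open FiniteLattice L

  BRel : Set
  BRel = Carrier → Carrier → Bool

  _∈_ : Carrier × Carrier → BRel → Set
  (x , y) ∈ T = T x y ≡ true

  _⊆_ : BRel → BRel → Set
  A ⊆ B = ∀ x y → (x , y) ∈ A → (x , y) ∈ B

  _≐_ : BRel → BRel → Set
  A ≐ B = ∀ x y → A x y ≡ B x y

  -- transfer system: a subposet of ≤ (reflexive, antisymmetric automatically
  -- as a subrelation of ≤, transitive) closed under restriction
  record IsTransferSystem (T : BRel) : Set where
    field
      sub   : ∀ x y → (x , y) ∈ T → x ≤ y
      refl  : ∀ x → (x , x) ∈ T
      trans : ∀ x y z → (x , y) ∈ T → (y , z) ∈ T → (x , z) ∈ T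
      restr : ∀ x y w → (x , y) ∈ T → w ≤ y → ((x ∧ w) , w) ∈ T

  IsJoin : BRel → BRel → BRel → Set
  IsJoin A B C = IsTransferSystem C × A ⊆ C × B ⊆ C
               × (∀ D → IsTransferSystem D → A ⊆ D → B ⊆ D → C ⊆ D)

  Covers : BRel → BRel → Set
  Covers A B = IsTransferSystem A × IsTransferSystem B × A ⊆ B × ¬ (B ⊆ A)
             × (∀ S → IsTransferSystem S → A ⊆ S → S ⊆ B → ¬ (¬ (S ⊆ A) × ¬ (B ⊆ S)))

  IsJoinIrreducible : BRel → Set
  IsJoinIrreducible J = IsTransferSystem J
    × ¬ (∀ S → IsTransferSystem S → J ⊆ S)
    × (∀ A B → IsTransferSystem A → IsTransferSystem B → IsJoin A B J → J ≐ A ⊎ J ≐ B)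

  -- J is the join label of the cover R₁ ⋖ R: J join-irreducible,
  -- R₁ ∨ J = R and R₁ ∨ J_* = R₁ for the lower cover J_* of J
  IsJoinLabel : BRel → BRel → BRel → Set
  IsJoinLabel R₁ R J = IsJoinIrreducible J × IsJoin R₁ J R
    × (∀ K → Covers K J → IsJoin R₁ K R₁)

  IsTr : Carrier → Carrier → BRel → Set
  IsTr a b T = IsTransferSystem T × (a , b) ∈ T
    × (∀ S → IsTransferSystem S → (a , b) ∈ S → T ⊆ S)

  LiftsLeft : Carrier × Carrier → Carrier × Carrier → Set
  LiftsLeft (a , b) (c , d) = a ≤ c → b ≤ d → b ≤ c

  IsLiftingRel : BRel → BRel → Carrier × Carrier → Set
  IsLiftingRel R₁ R (a , b) = (a , b) ∈ R × a ≢ b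
    × (∀ c d → (c , d) ∈ R₁ → LiftsLeft (a , b) (c , d))

{-# OPTIONS --safe #-}
module Submission where

-- Call (a , b) ∈ R ∖ R₁ minimal new if its proper restrictions (a ∧ w , w), w < b, all lie
-- in R₁; taking b minimal gives one.  Composing (a , c ∧ b) with the restriction (c ∧ b , b)
-- of some (c , d) ∈ R₁ shows that a minimal new pair lifts on the left every relation of R₁.
-- Conversely, the pairs of R that a lifting pair (a , b) lifts on the left form a transfer
-- system containing R₁ but not (a , b); by the cover it is R₁, so every pair of R ∖ R₁ lies
-- above (a , b), which makes the lifting pair unique.
-- Tr(a , b) is join-irreducible with lower cover Tr(a , b) ∖ (a , b).  For a transfer system
-- D ⊇ R₁ ∪ Tr(a , b), R ∩ D lies between R₁ and R and contains (a , b), so it is R; hence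
-- R₁ ∨ Tr(a , b) = R.  Conversely a join-irreducible J equals Tr(p , q) for any non-trivial
-- pair (p , q) of J that is neither a composite nor a restriction of other pairs (take q,
-- then p, maximal).  If J labels the cover, its lower cover J ∖ (p , q) lies in R₁, so
-- (p , q) is minimal new and hence equal to (a , b).

open import Defs
open import Data.Bool using (true)
open import Data.Bool.Properties using (⇔→≡) renaming (_≟_ to _≟ᵇ_)
open import Data.Empty using (⊥-elim)
open import Data.Fin using (Fin)
open import Data.Fin.Induction using (spo-wellFounded)
open import Data.Fin.Properties using (any?)
open import Data.Nat using (ℕ)
open import Data.Product using (Σ; ∃; ∃₂; _×_; _,_; proj₁; proj₂)
open import Data.Product.Properties using (≡-dec)
open import Data.Sum using (_⊎_; inj₁; inj₂; [_,_]′)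
open import Function using (_∘_; flip; mk⇔)
open import Function.Bundles using (_↔_; Inverse)
open import Induction.WellFounded using (WellFounded; Acc; acc; module Subrelation)
open import Relation.Binary using (Rel; Decidable; DecidableEquality)
open import Relation.Binary.Structures using (IsStrictPartialOrder)
open import Relation.Binary.Lattice using (Lattice; IsLattice)
open import Relation.Binary.PropositionalEquality
  using (_≡_; _≢_; refl; sym; trans; cong; cong₂; subst; subst₂)
open import Relation.Nullary using (¬_; Dec; yes; no; does)
open import Relation.Nullary.Decidable
  using (dec-true; decidable-stable; map′; ¬?; _×-dec_; _⊎-dec_; _→-dec_)
open import Relation.Unary using (Pred)
import Relation.Unary as U
import Relation.Binary.Construct.On as On
import Relation.Binary.Construct.Flip.EqAndOrd as Flip
import Relation.Binary.Construct.NonStrictToStrict as NonStrictToStrict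
import Relation.Binary.Properties.Poset as PosetProperties
import Relation.Binary.Lattice.Properties.MeetSemilattice as MeetSemilatticeProperties

module FiniteSearch {a} {A : Set a} {n : ℕ} (finite : A ↔ Fin n) where
  open Inverse finite using (to; from; strictlyInverseʳ)

  ∃? : ∀ {p} {P : Pred A p} → U.Decidable P → Dec (∃ P)
  ∃? {P = P} P? =
    map′ (λ (i , Pi) → from i , Pi)
         (λ (x , Px) → to x , subst P (sym (strictlyInverseʳ x)) Px)
         (any? (P? ∘ from))

  module _ {ℓ₁ ℓ₂} {_≈_ : Rel A ℓ₁} {_<_ : Rel A ℓ₂}
           (spo : IsStrictPartialOrder _≈_ _<_) where

    <-wellFounded : WellFounded _<_
    <-wellFounded =
      Subrelation.wellFounded through-Fin
        (On.wellFounded to (spo-wellFounded (On.isStrictPartialOrder from spo)))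
      where
      through-Fin : ∀ {x y} → x < y → from (to x) < from (to y)
      through-Fin {x} {y} = subst₂ _<_ (sym (strictlyInverseʳ x)) (sym (strictlyInverseʳ y))

    minimal : ∀ {p} {P : Pred A p} → Decidable _<_ → U.Decidable P → ∀ {x} → P x →
              ∃ λ y → P y × (∀ {z} → z < y → ¬ P z)
    minimal {P = P} _<?_ P? {x} = descend (<-wellFounded x)
      where
      descend : ∀ {y} → Acc _<_ y → P y → ∃ λ m → P m × (∀ {z} → z < m → ¬ P z)
      descend {y} (acc below) Py with ∃? (λ z → (z <? y) ×-dec P? z)
      ... | yes (z , z<y , Pz) = descend (below z<y) Pz
      ... | no  ∄ = y , Py , λ z<y Pz → ∄ (_ , z<y , Pz)

module TransferSystemLattice (L : FiniteLattice) where
  open FiniteLattice L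
  open TransferSystems L
  module TS = IsTransferSystem

  open IsLattice isLattice using (antisym; x∧y≤x; x∧y≤y; ∧-greatest)
    renaming (refl to ≤-refl; trans to ≤-trans)

  lattice : Lattice _ _ _
  lattice = record { isLattice = isLattice }

  open PosetProperties (Lattice.poset lattice) using (_<_; <-isStrictPartialOrder; <⇒≱; ≤-dec⇒≈-dec)
  open MeetSemilatticeProperties (Lattice.meetSemilattice lattice)
    using (∧-comm; ∧-assoc; y≤x⇒x∧y≈y)

  _≟_ : DecidableEquality Carrier
  _≟_ = ≤-dec⇒≈-dec _≤?_

  _<?_ : Decidable _<_
  _<?_ = NonStrictToStrict.<-decidable _≡_ _≤_ _≟_ _≤?_

  open FiniteSearch finite using (∃?; minimal)

  minimal< : ∀ {p} {P : Pred Carrier p} → U.Decidable P → ∀ {x} → P x →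
             ∃ λ y → P y × (∀ {z} → z < y → ¬ P z)
  minimal< = minimal <-isStrictPartialOrder _<?_

  maximal< : ∀ {p} {P : Pred Carrier p} → U.Decidable P → ∀ {x} → P x →
             ∃ λ y → P y × (∀ {z} → y < z → ¬ P z)
  maximal< = minimal (Flip.isStrictPartialOrder <-isStrictPartialOrder) (flip _<?_)

  x≤y⇒x∧y≡x : ∀ {x y} → x ≤ y → x ∧ y ≡ x
  x≤y⇒x∧y≡x {x} {y} x≤y = trans (∧-comm x y) (y≤x⇒x∧y≈y x≤y)

  w≤y⇒[x∧y]∧w≡x∧w : ∀ {x y w} → w ≤ y → (x ∧ y) ∧ w ≡ x ∧ w
  w≤y⇒[x∧y]∧w≡x∧w {x} {y} {w} w≤y = trans (∧-assoc x y w) (cong (x ∧_) (y≤x⇒x∧y≈y w≤y))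

  _∈?_ : ∀ xy T → Dec (xy ∈ T)
  (x , y) ∈? T = T x y ≟ᵇ true

  ⊆-stable : ∀ {A B} → ¬ ¬ (A ⊆ B) → A ⊆ B
  ⊆-stable {B = B} ¬¬A⊆B x y xy∈A =
    decidable-stable ((x , y) ∈? B) (λ xy∉B → ¬¬A⊆B (λ A⊆B → xy∉B (A⊆B x y xy∈A)))

  ⊆-antisym : ∀ {A B} → A ⊆ B → B ⊆ A → A ≐ B
  ⊆-antisym A⊆B B⊆A x y = ⇔→≡ (mk⇔ (A⊆B x y) (B⊆A x y))

  ≐⇒⊆ : ∀ {A B} → A ≐ B → A ⊆ B
  ≐⇒⊆ A≐B x y xy∈A = trans (sym (A≐B x y)) xy∈A

  ⊈⇒∃ : ∀ {A B} → ¬ (A ⊆ B) → ∃₂ λ x y → (x , y) ∈ A × ¬ (x , y) ∈ B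
  ⊈⇒∃ {A} {B} A⊈B with ∃? (λ x → ∃? (λ y → ((x , y) ∈? A) ×-dec ¬? ((x , y) ∈? B)))
  ... | yes witness = witness
  ... | no  ∄ = ⊥-elim (A⊈B (λ x y xy∈A →
          decidable-stable ((x , y) ∈? B) (λ xy∉B → ∄ (x , y , xy∈A , xy∉B))))

  covers-⊇ : ∀ {A B S} → Covers A B → IsTransferSystem S → A ⊆ S → S ⊆ B → ¬ (S ⊆ A) → B ⊆ S
  covers-⊇ (_ , _ , _ , _ , nothing-between) S-isTS A⊆S S⊆B S⊈A =
    ⊆-stable (λ B⊈S → nothing-between _ S-isTS A⊆S S⊆B (S⊈A , B⊈S))

  covers-⊆ : ∀ {A B S} → Covers A B → IsTransferSystem S → A ⊆ S → S ⊆ B → ¬ (B ⊆ S) → S ⊆ A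
  covers-⊆ (_ , _ , _ , _ , nothing-between) S-isTS A⊆S S⊆B B⊈S =
    ⊆-stable (λ S⊈A → nothing-between _ S-isTS A⊆S S⊆B (S⊈A , B⊈S))

  ∉⇒≢ : ∀ {T x y} → IsTransferSystem T → ¬ (x , y) ∈ T → x ≢ y
  ∉⇒≢ {x = x} T-isTS xy∉T refl = xy∉T (TS.refl T-isTS x)

  isJoin-absorb : ∀ {A B} → IsTransferSystem A → B ⊆ A → IsJoin A B A
  isJoin-absorb A-isTS B⊆A = A-isTS , (λ _ _ xy∈A → xy∈A) , B⊆A , λ _ _ A⊆D _ → A⊆D

  ⟦_⟧ : ∀ {P : Carrier → Carrier → Set} → Decidable P → BRel
  ⟦ P? ⟧ x y = does (P? x y)

  ∈⟦⟧⁺ : ∀ {P} (P? : Decidable P) {x y} → P x y → (x , y) ∈ ⟦ P? ⟧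
  ∈⟦⟧⁺ P? {x} {y} = dec-true (P? x y)

  ∈⟦⟧⁻ : ∀ {P} (P? : Decidable P) {x y} → (x , y) ∈ ⟦ P? ⟧ → P x y
  ∈⟦⟧⁻ P? {x} {y} xy∈P with P? x y | xy∈P
  ... | yes Pxy | _ = Pxy
  ... | no  _   | ()

  infix 25 _∣_
  _∣_ : ∀ {P} → BRel → Decidable P → BRel
  R ∣ P? = ⟦ (λ x y → ((x , y) ∈? R) ×-dec P? x y) ⟧

  ∈-∣⁺ : ∀ {P} R (P? : Decidable P) {x y} → (x , y) ∈ R → P x y → (x , y) ∈ R ∣ P?
  ∈-∣⁺ R P? xy∈R Pxy = ∈⟦⟧⁺ (λ x y → ((x , y) ∈? R) ×-dec P? x y) (xy∈R , Pxy)

  ∈-∣⁻ : ∀ {P} R (P? : Decidable P) {x y} → (x , y) ∈ R ∣ P? → (x , y) ∈ R × P x y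
  ∈-∣⁻ R P? = ∈⟦⟧⁻ (λ x y → ((x , y) ∈? R) ×-dec P? x y)

  ∣-isTransferSystem : ∀ {P} {R} (P? : Decidable P) → IsTransferSystem R →
    (∀ x → P x x) →
    (∀ {x y z} → (x , y) ∈ R → (y , z) ∈ R → P x y → P y z → P x z) →
    (∀ {x y w} → (x , y) ∈ R → w ≤ y → P x y → P (x ∧ w) w) →
    IsTransferSystem (R ∣ P?)
  ∣-isTransferSystem {R = R} P? R-isTS P-refl P-trans P-restr = record
    { sub   = λ x y xy → TS.sub R-isTS x y (proj₁ (∈-∣⁻ R P? xy))
    ; refl  = λ x → ∈-∣⁺ R P? (TS.refl R-isTS x) (P-refl x)
    ; trans = λ x y z xy yz →
        let xy∈R , Pxy = ∈-∣⁻ R P? xy ; yz∈R , Pyz = ∈-∣⁻ R P? yz in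
        ∈-∣⁺ R P? (TS.trans R-isTS x y z xy∈R yz∈R) (P-trans xy∈R yz∈R Pxy Pyz)
    ; restr = λ x y w xy w≤y →
        let xy∈R , Pxy = ∈-∣⁻ R P? xy in
        ∈-∣⁺ R P? (TS.restr R-isTS x y w xy∈R w≤y) (P-restr xy∈R w≤y Pxy)
    }

  infix 25 _∩_
  _∩_ : BRel → BRel → BRel
  R ∩ D = R ∣ λ x y → (x , y) ∈? D

  ∈-∩⁺ : ∀ R D {x y} → (x , y) ∈ R → (x , y) ∈ D → (x , y) ∈ R ∩ D
  ∈-∩⁺ R D = ∈-∣⁺ R (λ x y → (x , y) ∈? D)

  ∈-∩⁻ : ∀ R D {x y} → (x , y) ∈ R ∩ D → (x , y) ∈ R × (x , y) ∈ D
  ∈-∩⁻ R D = ∈-∣⁻ R (λ x y → (x , y) ∈? D)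

  ∩-isTransferSystem : ∀ {R D} → IsTransferSystem R → IsTransferSystem D → IsTransferSystem (R ∩ D)
  ∩-isTransferSystem {D = D} R-isTS D-isTS =
    ∣-isTransferSystem (λ x y → (x , y) ∈? D) R-isTS (TS.refl D-isTS)
      (λ {x} {y} {z} _ _ → TS.trans D-isTS x y z)
      (λ {x} {y} {w} _ → flip (TS.restr D-isTS x y w))

  LiftsLeft? : ∀ a b → Decidable (λ c d → LiftsLeft (a , b) (c , d))
  LiftsLeft? a b c d = a ≤? c →-dec b ≤? d →-dec b ≤? c

  ¬LiftsLeft-self : ∀ {a b} → a ≤ b → a ≢ b → ¬ LiftsLeft (a , b) (a , b)
  ¬LiftsLeft-self a≤b a≢b lifts = a≢b (antisym a≤b (lifts ≤-refl ≤-refl))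

  liftedBy-isTransferSystem : ∀ {R} a b → IsTransferSystem R → IsTransferSystem (R ∣ LiftsLeft? a b)
  liftedBy-isTransferSystem {R} a b R-isTS =
    ∣-isTransferSystem (LiftsLeft? a b) R-isTS (λ _ _ b≤x → b≤x)
      (λ {x} {y} xy∈R _ lifts-xy lifts-yz a≤x b≤z →
        let a≤y = ≤-trans a≤x (TS.sub R-isTS x y xy∈R) in
        lifts-xy a≤x (lifts-yz a≤y b≤z))
      (λ _ w≤y lifts-xy a≤x∧w b≤w →
        ∧-greatest (lifts-xy (≤-trans a≤x∧w (x∧y≤x _ _)) (≤-trans b≤w w≤y)) b≤w)

  ≢-pair? : ∀ pq → Decidable (λ x y → (x , y) ≢ pq)
  ≢-pair? pq x y = ¬? (≡-dec _≟_ _≟_ (x , y) pq)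

  infix 25 _∖_
  _∖_ : BRel → Carrier × Carrier → BRel
  J ∖ pq = J ∣ (≢-pair? pq)

  ∈-∖⁺ : ∀ J {pq x y} → (x , y) ∈ J → (x , y) ≢ pq → (x , y) ∈ J ∖ pq
  ∈-∖⁺ J {pq} = ∈-∣⁺ J (≢-pair? pq)

  ∈-∖⁻ : ∀ J {pq x y} → (x , y) ∈ J ∖ pq → (x , y) ∈ J × (x , y) ≢ pq
  ∈-∖⁻ J {pq} = ∈-∣⁻ J (≢-pair? pq)

  ∉-∖ : ∀ J {pq} → ¬ pq ∈ J ∖ pq
  ∉-∖ J pq∈J∖pq = proj₂ (∈-∖⁻ J pq∈J∖pq) refl

  ∖-⊆ : ∀ {J pq} → J ∖ pq ⊆ J
  ∖-⊆ {J} _ _ xy∈J∖pq = proj₁ (∈-∖⁻ J xy∈J∖pq)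

  ⊆-∖ : ∀ {S J p q} → S ⊆ J → ¬ (p , q) ∈ S → S ⊆ J ∖ (p , q)
  ⊆-∖ {J = J} S⊆J pq∉S x y xy∈S = ∈-∖⁺ J (S⊆J x y xy∈S) λ { refl → pq∉S xy∈S }

  ∖⊆⇒⊆ : ∀ {J D p q} → (p , q) ∈ D → J ∖ (p , q) ⊆ D → J ⊆ D
  ∖⊆⇒⊆ {J} {D} {p} {q} pq∈D J∖pq⊆D x y xy∈J with ≡-dec _≟_ _≟_ (x , y) (p , q)
  ... | yes refl = pq∈D
  ... | no  xy≢pq = J∖pq⊆D x y (∈-∖⁺ J xy∈J xy≢pq)

  record Indecomposable (J : BRel) (p q : Carrier) : Set where
    field
      unfactorable : ∀ {y} → (p , y) ∈ J → (y , q) ∈ J → y ≡ p ⊎ y ≡ q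
      unrestricted : ∀ {x y} → (x , y) ∈ J → q < y → x ∧ q ≢ p

  ∖-isTransferSystem : ∀ {J p q} → IsTransferSystem J → p ≢ q → Indecomposable J p q →
                       IsTransferSystem (J ∖ (p , q))
  ∖-isTransferSystem {J} {p} {q} J-isTS p≢q indecomposable =
    ∣-isTransferSystem (≢-pair? (p , q)) J-isTS (λ { _ refl → p≢q refl })
      (λ { py∈J yq∈J py≢pq yq≢pq refl →
             [ (λ { refl → yq≢pq refl }) , (λ { refl → py≢pq refl }) ]′ (unfactorable py∈J yq∈J) })
      restriction
    where
    open Indecomposable indecomposable
    restriction : ∀ {x y w} → (x , y) ∈ J → w ≤ y → (x , y) ≢ (p , q) → (x ∧ w , w) ≢ (p , q)
    restriction {x} {y} {w} xy∈J w≤y xy≢pq refl with w ≟ y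
    ... | yes refl = xy≢pq (cong (_, w) (sym (x≤y⇒x∧y≡x (TS.sub J-isTS x w xy∈J))))
    ... | no  w≢y = unrestricted xy∈J (w≤y , w≢y) refl

  ∖-covers : ∀ {J p q} → IsTransferSystem J → (p , q) ∈ J → p ≢ q → Indecomposable J p q →
             Covers (J ∖ (p , q)) J
  ∖-covers {J} {p} {q} J-isTS pq∈J p≢q indecomposable =
    ∖-isTransferSystem J-isTS p≢q indecomposable , J-isTS , ∖-⊆ ,
    (λ J⊆J∖pq → ∉-∖ J (J⊆J∖pq p q pq∈J)) ,
    λ _ _ J∖pq⊆S S⊆J (S⊈J∖pq , J⊈S) → [ S⊈J∖pq , J⊈S ]′ (dichotomy J∖pq⊆S S⊆J)
    where
    dichotomy : ∀ {S} → J ∖ (p , q) ⊆ S → S ⊆ J → S ⊆ J ∖ (p , q) ⊎ J ⊆ S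
    dichotomy {S} J∖pq⊆S S⊆J with (p , q) ∈? S
    ... | yes pq∈S = inj₂ (∖⊆⇒⊆ pq∈S J∖pq⊆S)
    ... | no  pq∉S = inj₁ (⊆-∖ S⊆J pq∉S)

  InTr : Carrier → Carrier → Carrier → Carrier → Set
  InTr a b x y = x ≡ y ⊎ (y ≤ b × x ≡ a ∧ y)

  InTr? : ∀ a b → Decidable (InTr a b)
  InTr? a b x y = (x ≟ y) ⊎-dec ((y ≤? b) ×-dec (x ≟ (a ∧ y)))

  Tr : Carrier → Carrier → BRel
  Tr a b = ⟦ InTr? a b ⟧

  InTr-compose : ∀ {a b x y z} → InTr a b x y → InTr a b y z → x ≡ y ⊎ y ≡ z
  InTr-compose (inj₁ x≡y) _ = inj₁ x≡y
  InTr-compose (inj₂ _) (inj₁ y≡z) = inj₂ y≡z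
  InTr-compose {a} {z = z} (inj₂ (_ , refl)) (inj₂ (_ , refl)) = inj₁ (y≤x⇒x∧y≈y (x∧y≤x a z))

  InTr-restrict : ∀ {a b x y w} → InTr a b x y → w ≤ y → InTr a b (x ∧ w) w
  InTr-restrict (inj₁ refl) w≤y = inj₁ (y≤x⇒x∧y≈y w≤y)
  InTr-restrict (inj₂ (y≤b , refl)) w≤y = inj₂ (≤-trans w≤y y≤b , w≤y⇒[x∧y]∧w≡x∧w w≤y)

  Tr-isTransferSystem : ∀ a b → IsTransferSystem (Tr a b)
  Tr-isTransferSystem a b = record
    { sub   = λ x y xy → below (∈⟦⟧⁻ (InTr? a b) xy)
    ; refl  = λ x → ∈⟦⟧⁺ (InTr? a b) (inj₁ refl)
    ; trans = λ x y z xy yz → [ (λ { refl → yz }) , (λ { refl → xy }) ]′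
                (InTr-compose (∈⟦⟧⁻ (InTr? a b) xy) (∈⟦⟧⁻ (InTr? a b) yz))
    ; restr = λ x y w xy w≤y → ∈⟦⟧⁺ (InTr? a b) (InTr-restrict (∈⟦⟧⁻ (InTr? a b) xy) w≤y)
    }
    where
    below : ∀ {x y} → InTr a b x y → x ≤ y
    below (inj₁ refl) = ≤-refl
    below (inj₂ (_ , refl)) = x∧y≤y a _

  Tr-contains : ∀ {a b} → a ≤ b → (a , b) ∈ Tr a b
  Tr-contains {a} {b} a≤b = ∈⟦⟧⁺ (InTr? a b) (inj₂ (≤-refl , sym (x≤y⇒x∧y≡x a≤b)))

  Tr-least : ∀ {a b S} → IsTransferSystem S → (a , b) ∈ S → Tr a b ⊆ S
  Tr-least {a} {b} S-isTS ab∈S x y xy∈Tr with ∈⟦⟧⁻ (InTr? a b) xy∈Tr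
  ... | inj₁ refl = TS.refl S-isTS x
  ... | inj₂ (y≤b , refl) = TS.restr S-isTS a b y ab∈S y≤b

  Tr-isTr : ∀ {a b} → a ≤ b → IsTr a b (Tr a b)
  Tr-isTr {a} {b} a≤b = Tr-isTransferSystem a b , Tr-contains a≤b , λ _ → Tr-least

  Tr-indecomposable : ∀ {a b} → a ≢ b → Indecomposable (Tr a b) a b
  Tr-indecomposable {a} {b} a≢b = record
    { unfactorable = λ ay by → [ inj₁ ∘ sym , inj₂ ]′
                       (InTr-compose (∈⟦⟧⁻ (InTr? a b) ay) (∈⟦⟧⁻ (InTr? a b) by))
    ; unrestricted = λ xy b<y → unrestricted (∈⟦⟧⁻ (InTr? a b) xy) b<y
    }
    where
    unrestricted : ∀ {x y} → InTr a b x y → b < y → x ∧ b ≢ a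
    unrestricted (inj₁ refl) (b≤x , _) x∧b≡a = a≢b (trans (sym x∧b≡a) (y≤x⇒x∧y≈y b≤x))
    unrestricted (inj₂ (y≤b , _)) b<y _ = <⇒≱ b<y y≤b

  isJoin-Tr-∖ : ∀ {J p q} → IsTransferSystem J → (p , q) ∈ J → IsJoin (Tr p q) (J ∖ (p , q)) J
  isJoin-Tr-∖ J-isTS pq∈J =
    J-isTS , Tr-least J-isTS pq∈J , ∖-⊆ ,
    λ _ _ Tr⊆D J∖pq⊆D → ∖⊆⇒⊆ (Tr⊆D _ _ (Tr-contains (TS.sub J-isTS _ _ pq∈J))) J∖pq⊆D

  Tr-isJoinIrreducible : ∀ {a b} → a ≤ b → a ≢ b → IsJoinIrreducible (Tr a b)
  Tr-isJoinIrreducible {a} {b} a≤b a≢b = Tr-isTransferSystem a b , not-least , prime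
    where
    Tr∖ab-isTS : IsTransferSystem (Tr a b ∖ (a , b))
    Tr∖ab-isTS = ∖-isTransferSystem (Tr-isTransferSystem a b) a≢b (Tr-indecomposable a≢b)

    not-least : ¬ (∀ S → IsTransferSystem S → Tr a b ⊆ S)
    not-least least = ∉-∖ (Tr a b) (least _ Tr∖ab-isTS a b (Tr-contains a≤b))

    prime : ∀ A B → IsTransferSystem A → IsTransferSystem B → IsJoin A B (Tr a b) →
            Tr a b ≐ A ⊎ Tr a b ≐ B
    prime A B A-isTS B-isTS (_ , A⊆Tr , B⊆Tr , least) with (a , b) ∈? A | (a , b) ∈? B
    ... | yes ab∈A | _ = inj₁ (⊆-antisym (Tr-least A-isTS ab∈A) A⊆Tr)
    ... | no  _ | yes ab∈B = inj₂ (⊆-antisym (Tr-least B-isTS ab∈B) B⊆Tr)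
    ... | no  ab∉A | no ab∉B = ⊥-elim (∉-∖ (Tr a b)
          (least _ Tr∖ab-isTS (⊆-∖ A⊆Tr ab∉A) (⊆-∖ B⊆Tr ab∉B) a b (Tr-contains a≤b)))

  joinIrreducible-≐-Tr : ∀ {J p q} → IsJoinIrreducible J → (p , q) ∈ J → p ≢ q →
                         Indecomposable J p q → J ≐ Tr p q
  joinIrreducible-≐-Tr {J} {p} {q} (J-isTS , _ , prime) pq∈J p≢q indecomposable =
    [ (λ J≐Tr → J≐Tr) , (λ J≐J∖pq → ⊥-elim (∉-∖ J (≐⇒⊆ J≐J∖pq p q pq∈J))) ]′
      (prime _ _ (Tr-isTransferSystem p q) (∖-isTransferSystem J-isTS p≢q indecomposable)
             (isJoin-Tr-∖ J-isTS pq∈J))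

  indecomposable-exists : ∀ {J x y} → IsTransferSystem J → (x , y) ∈ J → x ≢ y →
                          ∃₂ λ p q → (p , q) ∈ J × p ≢ q × Indecomposable J p q
  indecomposable-exists {J} J-isTS xy∈J x≢y
    with maximal< (λ q → ∃? λ p → ((p , q) ∈? J) ×-dec ¬? (p ≟ q)) (_ , xy∈J , x≢y)
  ... | q , (_ , p₀q∈J , p₀≢q) , q-max
    with maximal< (λ p → ((p , q) ∈? J) ×-dec ¬? (p ≟ q)) (p₀q∈J , p₀≢q)
  ... | p , (pq∈J , p≢q) , p-max = p , q , pq∈J , p≢q , record
    { unfactorable = unfactorable
    ; unrestricted = unrestricted
    }
    where
    unfactorable : ∀ {y} → (p , y) ∈ J → (y , q) ∈ J → y ≡ p ⊎ y ≡ q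
    unfactorable {y} py∈J yq∈J with y ≟ p | y ≟ q
    ... | yes y≡p | _ = inj₁ y≡p
    ... | no  _   | yes y≡q = inj₂ y≡q
    ... | no  y≢p | no y≢q = ⊥-elim (p-max (TS.sub J-isTS p y py∈J , y≢p ∘ sym) (yq∈J , y≢q))

    unrestricted : ∀ {x y} → (x , y) ∈ J → q < y → x ∧ q ≢ p
    unrestricted {x} xy∈J q<y@(q≤y , _) x∧q≡p = q-max q<y (x , xy∈J , nontrivial)
      where
      nontrivial : x ≢ _
      nontrivial refl = p≢q (trans (sym x∧q≡p) (y≤x⇒x∧y≈y q≤y))

  module Cover {R₁ R : BRel} (cover : Covers R₁ R) where
    R₁-isTS : IsTransferSystem R₁
    R₁-isTS = proj₁ cover

    R-isTS : IsTransferSystem R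
    R-isTS = proj₁ (proj₂ cover)

    R₁⊆R : R₁ ⊆ R
    R₁⊆R = proj₁ (proj₂ (proj₂ cover))

    R⊈R₁ : ¬ (R ⊆ R₁)
    R⊈R₁ = proj₁ (proj₂ (proj₂ (proj₂ cover)))

    IsMinimalNew : Carrier → Carrier → Set
    IsMinimalNew a b = (a , b) ∈ R × ¬ (a , b) ∈ R₁ × (∀ {w} → w < b → (a ∧ w , w) ∈ R₁)

    minimalNew-exists : ∃₂ IsMinimalNew
    minimalNew-exists with ⊈⇒∃ R⊈R₁
    ... | _ , y , xy∈R , xy∉R₁
      with minimal< (λ b → ∃? λ a → ((a , b) ∈? R) ×-dec ¬? ((a , b) ∈? R₁)) (_ , xy∈R , xy∉R₁)
    ... | b , (a , ab∈R , ab∉R₁) , b-min = a , b , ab∈R , ab∉R₁ , restrictions∈R₁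
      where
      restrictions∈R₁ : ∀ {w} → w < b → (a ∧ w , w) ∈ R₁
      restrictions∈R₁ {w} w<b = decidable-stable ((a ∧ w , w) ∈? R₁) λ a∧w,w∉R₁ →
        b-min w<b (a ∧ w , TS.restr R-isTS a b w ab∈R (proj₁ w<b) , a∧w,w∉R₁)

    minimalNew⇒lifting : ∀ {a b} → IsMinimalNew a b → IsLiftingRel R₁ R (a , b)
    minimalNew⇒lifting {a} {b} (ab∈R , ab∉R₁ , restrictions∈R₁) = ab∈R , ∉⇒≢ R₁-isTS ab∉R₁ , lifts
      where
      lifts : ∀ c d → (c , d) ∈ R₁ → LiftsLeft (a , b) (c , d)
      lifts c d cd∈R₁ a≤c b≤d = decidable-stable (b ≤? c) λ b≰c →
        ab∉R₁ (TS.trans R₁-isTS a (c ∧ b) b (a→c∧b b≰c) (TS.restr R₁-isTS c d b cd∈R₁ b≤d))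
        where
        a→c∧b : ¬ b ≤ c → (a , c ∧ b) ∈ R₁
        a→c∧b b≰c = subst (λ u → (u , c ∧ b) ∈ R₁)
          (x≤y⇒x∧y≡x (∧-greatest a≤c (TS.sub R-isTS a b ab∈R)))
          (restrictions∈R₁ (x∧y≤y c b , λ c∧b≡b → b≰c (subst (_≤ c) c∧b≡b (x∧y≤x c b))))

    lifting∉R₁ : ∀ {a b} → IsLiftingRel R₁ R (a , b) → ¬ (a , b) ∈ R₁
    lifting∉R₁ {a} {b} (ab∈R , a≢b , lifts) ab∈R₁ =
      ¬LiftsLeft-self (TS.sub R-isTS a b ab∈R) a≢b (lifts a b ab∈R₁)

    lifting-below : ∀ {a b x y} → IsLiftingRel R₁ R (a , b) → (x , y) ∈ R → ¬ (x , y) ∈ R₁ →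
                    a ≤ x × b ≤ y
    lifting-below {a} {b} {x} {y} (ab∈R , a≢b , lifts) xy∈R xy∉R₁ =
      decidable-stable (a ≤? x) (λ a≰x → not-lifted λ a≤x → ⊥-elim (a≰x a≤x)) ,
      decidable-stable (b ≤? y) (λ b≰y → not-lifted λ _ b≤y → ⊥-elim (b≰y b≤y))
      where
      Lifted : BRel
      Lifted = R ∣ LiftsLeft? a b

      Lifted⊆R₁ : Lifted ⊆ R₁
      Lifted⊆R₁ = covers-⊆ cover (liftedBy-isTransferSystem a b R-isTS)
        (λ c d cd∈R₁ → ∈-∣⁺ R (LiftsLeft? a b) (R₁⊆R c d cd∈R₁) (lifts c d cd∈R₁))
        (λ c d cd∈Lifted → proj₁ (∈-∣⁻ R (LiftsLeft? a b) cd∈Lifted))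
        (λ R⊆Lifted → ¬LiftsLeft-self (TS.sub R-isTS a b ab∈R) a≢b
                         (proj₂ (∈-∣⁻ R (LiftsLeft? a b) (R⊆Lifted a b ab∈R))))

      not-lifted : ¬ LiftsLeft (a , b) (x , y)
      not-lifted lifted = xy∉R₁ (Lifted⊆R₁ x y (∈-∣⁺ R (LiftsLeft? a b) xy∈R lifted))

    lifting-unique : ∀ {a b a′ b′} → IsLiftingRel R₁ R (a , b) → IsLiftingRel R₁ R (a′ , b′) →
                     (a′ , b′) ≡ (a , b)
    lifting-unique ab-lifting@(ab∈R , _) ab′-lifting@(ab′∈R , _) =
      let a≤a′ , b≤b′ = lifting-below ab-lifting ab′∈R (lifting∉R₁ ab′-lifting)
          a′≤a , b′≤b = lifting-below ab′-lifting ab∈R (lifting∉R₁ ab-lifting)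
      in cong₂ _,_ (antisym a′≤a a≤a′) (antisym b′≤b b≤b′)

    Tr-isJoin : ∀ {a b} → (a , b) ∈ R → ¬ (a , b) ∈ R₁ → IsJoin R₁ (Tr a b) R
    Tr-isJoin {a} {b} ab∈R ab∉R₁ = R-isTS , R₁⊆R , Tr-least R-isTS ab∈R , least
      where
      least : ∀ D → IsTransferSystem D → R₁ ⊆ D → Tr a b ⊆ D → R ⊆ D
      least D D-isTS R₁⊆D Tr⊆D x y xy∈R = proj₂ (∈-∩⁻ R D (R⊆R∩D x y xy∈R))
        where
        R⊆R∩D : R ⊆ R ∩ D
        R⊆R∩D = covers-⊇ cover (∩-isTransferSystem R-isTS D-isTS)
          (λ c d cd∈R₁ → ∈-∩⁺ R D (R₁⊆R c d cd∈R₁) (R₁⊆D c d cd∈R₁))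
          (λ c d cd∈R∩D → proj₁ (∈-∩⁻ R D cd∈R∩D))
          (λ R∩D⊆R₁ → ab∉R₁ (R∩D⊆R₁ a b
            (∈-∩⁺ R D ab∈R (Tr⊆D a b (Tr-contains (TS.sub R-isTS a b ab∈R))))))

    minimalNew-lowerCover : ∀ {a b K} → IsMinimalNew a b → Covers K (Tr a b) → IsJoin R₁ K R₁
    minimalNew-lowerCover {a} {b} {K} (ab∈R , _ , restrictions∈R₁) (K-isTS , _ , K⊆Tr , Tr⊈K , _) =
      isJoin-absorb R₁-isTS K⊆R₁
      where
      K⊆R₁ : K ⊆ R₁
      K⊆R₁ x y xy∈K with ∈⟦⟧⁻ (InTr? a b) (K⊆Tr x y xy∈K)
      ... | inj₁ refl = TS.refl R₁-isTS x
      ... | inj₂ (y≤b , refl) with y ≟ b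
      ...   | yes refl = ⊥-elim (Tr⊈K (Tr-least K-isTS
                           (subst (λ u → (u , b) ∈ K) (x≤y⇒x∧y≡x (TS.sub R-isTS a b ab∈R)) xy∈K)))
      ...   | no  y≢b = restrictions∈R₁ (y≤b , y≢b)

    minimalNew-isJoinLabel : ∀ {a b} → IsMinimalNew a b → IsJoinLabel R₁ R (Tr a b)
    minimalNew-isJoinLabel new@(ab∈R , ab∉R₁ , _) =
      Tr-isJoinIrreducible (TS.sub R-isTS _ _ ab∈R) (∉⇒≢ R₁-isTS ab∉R₁) ,
      Tr-isJoin ab∈R ab∉R₁ ,
      λ _ → minimalNew-lowerCover new

    joinLabel⊈R₁ : ∀ {J} → IsJoinLabel R₁ R J → ¬ (J ⊆ R₁)
    joinLabel⊈R₁ (_ , (_ , _ , _ , least) , _) J⊆R₁ =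
      R⊈R₁ (least R₁ R₁-isTS (λ _ _ xy∈R₁ → xy∈R₁) J⊆R₁)

    indecomposable⇒minimalNew : ∀ {J p q} → IsJoinLabel R₁ R J → (p , q) ∈ J → p ≢ q →
                                Indecomposable J p q → IsMinimalNew p q
    indecomposable⇒minimalNew {J} {p} {q}
      J-label@((J-isTS , _) , (_ , _ , J⊆R , _) , lowerCovers) pq∈J p≢q indecomposable =
      J⊆R p q pq∈J ,
      (λ pq∈R₁ → joinLabel⊈R₁ J-label (∖⊆⇒⊆ pq∈R₁ J∖pq⊆R₁)) ,
      λ {w} (w≤q , w≢q) →
        J∖pq⊆R₁ _ _ (∈-∖⁺ J (TS.restr J-isTS p q w pq∈J w≤q) (w≢q ∘ cong proj₂))
      where
      J∖pq⊆R₁ : J ∖ (p , q) ⊆ R₁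
      J∖pq⊆R₁ = proj₁ (proj₂ (proj₂ (lowerCovers _ (∖-covers J-isTS pq∈J p≢q indecomposable))))

    joinLabel-minimalNew : ∀ {J} → IsJoinLabel R₁ R J → ∃₂ λ p q → IsMinimalNew p q × J ≐ Tr p q
    joinLabel-minimalNew J-label@(J-ji@(J-isTS , _) , _) with ⊈⇒∃ (joinLabel⊈R₁ J-label)
    ... | _ , _ , xy∈J , xy∉R₁ with indecomposable-exists J-isTS xy∈J (∉⇒≢ R₁-isTS xy∉R₁)
    ... | p , q , pq∈J , p≢q , indecomposable =
      p , q , indecomposable⇒minimalNew J-label pq∈J p≢q indecomposable ,
      joinIrreducible-≐-Tr J-ji pq∈J p≢q indecomposable

    joinLabel-unique : ∀ {a b J} → IsMinimalNew a b → IsJoinLabel R₁ R J → J ≐ Tr a b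
    joinLabel-unique {a} {b} {J} new J-label = via-minimalNew (joinLabel-minimalNew J-label)
      where
      via-minimalNew : (∃₂ λ p q → IsMinimalNew p q × J ≐ Tr p q) → J ≐ Tr a b
      via-minimalNew (p , q , new′ , J≐Tr) =
        subst (λ (p , q) → J ≐ Tr p q)
              (lifting-unique (minimalNew⇒lifting new) (minimalNew⇒lifting new′)) J≐Tr

open FiniteLattice
open TransferSystems

mainTheorem16 : (L : FiniteLattice) → (R₁ R : BRel L) → Covers L R₁ R →
    Σ (Carrier L × Carrier L) λ ab →
      IsLiftingRel L R₁ R ab
      × (∀ ab′ → IsLiftingRel L R₁ R ab′ → ab′ ≡ ab)
      × Σ (BRel L) (λ T → IsTr L (proj₁ ab) (proj₂ ab) T
          × IsJoinLabel L R₁ R T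
          × (∀ J → IsJoinLabel L R₁ R J → _≐_ L J T))
mainTheorem16 L R₁ R cover =
  let a , b , new = minimalNew-exists
      ab-lifting = minimalNew⇒lifting new
  in (a , b) , ab-lifting , (λ { (_ , _) ab′-lifting → lifting-unique ab-lifting ab′-lifting }) ,
     Tr a b , Tr-isTr (TS.sub R-isTS a b (proj₁ new)) , minimalNew-isJoinLabel new ,
     λ _ → joinLabel-unique new
  where
  open TransferSystemLattice L
  open Cover cover
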